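{- Let $p$ be an odd prime and let $n \in \mathbb{Z}/p\mathbb{Z}$ be a non-square. Define $$E = \{(t^2,t,t,1) : t \in \mathbb{Z}/p\mathbb{Z}\} \cup \{(nt^2,nt,t,n) : t \in \mathbb{Z}/p\mathbb{Z}\} \subseteq (\mathbb{Z}/p\mathbb{Z})^4$$ and $$A = \{(1,2i,0,i^2) : i \in \mathbb{Z}/p\mathbb{Z}\} \cup \{(0,0,-2ni,ni^2) : i \in \mathbb{Z}/p\mathbb{Z}\} \subseteq (\mathbb{Z}/p\mathbb{Z})^4.$$ Then $|E| = 2p$, $E$ is a spectral set with spectrum $A$, and $E$ is not a tiling set. In particular, for every odd prime $p$ there exists a spectral set of size $2p$ in $(\mathbb{Z}/p\mathbb{Z})^4$ that is not tiling.
   Context: For a prime $p$ and $d \ge 1$, a set $E \subseteq (\mathbb{Z}/p\mathbb{Z})^d$ is called tiling if there exists $T \subseteq (\mathbb{Z}/p\mathbb{Z})^d$ such that the translates $\{E + t : t \in T\}$ partition $(\mathbb{Z}/p\mathbb{Z})^d$. For $\mathbf{a} \in (\mathbb{Z}/p\mathbb{Z})^d$, the character $\chi_{\mathbf{a}}$ is the function $\chi_{\mathbf{a}}(\mathbf{x}) = e^{\frac{2\pi i}{p}(a_1x_1+\dots+a_dx_d)}$. Let $L^2(E)$ denote the space of functions $E \to \mathbb{C}$ with inner product $\langle f,g\rangle = \frac{1}{|E|}\sum_{x\in E} f(x)\overline{g(x)}$. The set $E$ is called spectral with spectrum $A \subseteq (\mathbb{Z}/p\mathbb{Z})^d$ if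 $\{\chi_{\mathbf{a}}|_E : \mathbf{a} \in A\}$ is an orthogonal basis of $L^2(E)$. -}

module Defs where

open import Data.Nat as ℕ using (ℕ; zero; suc; NonZero)
open import Data.Nat.DivMod using (_mod_)
open import Data.Integer as ℤ using (ℤ)
open import Data.Fin as Fin using (Fin; toℕ)
open import Data.Fin.Properties using () renaming (_≟_ to _≟F_)
open import Data.Vec as Vec using (Vec; []; _∷_; zipWith; foldr)
open import Data.Vec.Properties using (≡-dec)
open import Data.List as List using (List; allFin; deduplicate; length; _++_)
open import Data.List.Membership.Propositional using (_∈_)
open import Data.Product using (Σ; ∃; _×_; _,_)
open import Relation.Binary.PropositionalEquality using (_≡_)
open import Relation.Binary.Definitions using (DecidableEquality)
open import Relation.Nullary using (¬_)

ZMod : ℕ → Set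
ZMod p = Fin p

module _ {p : ℕ} .{{_ : NonZero p}} where

  infixl 6 _+ₚ_ _-ₚ_
  infixl 7 _*ₚ_

  _+ₚ_ : ZMod p → ZMod p → ZMod p
  a +ₚ b = (toℕ a ℕ.+ toℕ b) mod p

  _*ₚ_ : ZMod p → ZMod p → ZMod p
  a *ₚ b = (toℕ a ℕ.* toℕ b) mod p

  -ₚ_ : ZMod p → ZMod p
  -ₚ a = (p ℕ.∸ toℕ a) mod p

  _-ₚ_ : ZMod p → ZMod p → ZMod p
  a -ₚ b = a +ₚ (-ₚ b)

  [_]ₚ : ℕ → ZMod p
  [ k ]ₚ = k mod p

  IsSquare : ZMod p → Set
  IsSquare n = ∃ λ (x : ZMod p) → x *ₚ x ≡ n

Pt : ℕ → ℕ → Set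
Pt p d = Vec (ZMod p) d

module _ {p : ℕ} .{{_ : NonZero p}} {d : ℕ} where

  _≟ᵖ_ : DecidableEquality (Pt p d)
  _≟ᵖ_ = ≡-dec _≟F_

  _⊕_ : Pt p d → Pt p d → Pt p d
  _⊕_ = zipWith _+ₚ_

  dot : Pt p d → Pt p d → ZMod p
  dot a x = foldr _ _+ₚ_ [ 0 ]ₚ (zipWith _*ₚ_ a x)

-- The cyclotomic ring ℤ[ζ] ⊆ ℂ, ζ = e^{2πi/p}, p prime.
-- An element is written Σ_j c_j ζ^j (j ∈ ℤ/pℤ), given by the coefficient
-- function c : ZMod p → ℤ.  Two such expressions denote the same complex
-- number iff their difference is an integer multiple of 1 + ζ + … + ζ^{p-1}
-- (the minimal polynomial of ζ is Φ_p = 1 + x + … + x^{p-1}), i.e. iff the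
-- coefficient difference is constant.

Cyc : ℕ → Set
Cyc p = ZMod p → ℤ

module _ {p : ℕ} .{{_ : NonZero p}} where

  sumₚ : (ZMod p → ℤ) → ℤ
  sumₚ f = List.foldr ℤ._+_ (ℤ.+ 0) (List.map f (allFin p))

  _≈ᶜ_ : Cyc p → Cyc p → Set
  f ≈ᶜ g = ∃ λ (c : ℤ) → ∀ j → f j ℤ.- g j ≡ c

  0ᶜ : Cyc p
  0ᶜ _ = ℤ.+ 0

  _+ᶜ_ : Cyc p → Cyc p → Cyc p
  (f +ᶜ g) j = f j ℤ.+ g j

  -- product: ζ^i ζ^j = ζ^{i+j}
  _*ᶜ_ : Cyc p → Cyc p → Cyc p
  (f *ᶜ g) k = sumₚ (λ j → f j ℤ.* g (k -ₚ j))

  -- complex conjugation: conj(ζ^j) = ζ^{-j}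
  conjᶜ : Cyc p → Cyc p
  conjᶜ f j = f (-ₚ j)

  ζ^ : ZMod p → Cyc p
  ζ^ k j with k ≟F j
  ... | Relation.Nullary.yes _ = ℤ.+ 1
  ... | Relation.Nullary.no  _ = ℤ.+ 0

  sumᶜ : List (Cyc p) → Cyc p
  sumᶜ = List.foldr _+ᶜ_ 0ᶜ

-- Finite subsets of (ℤ/pℤ)^d, given by a list of their elements
-- (membership _∈_; duplicates are irrelevant).

module _ {p : ℕ} .{{_ : NonZero p}} {d : ℕ} where

  elems : List (Pt p d) → List (Pt p d)
  elems = deduplicate _≟ᵖ_

  card : List (Pt p d) → ℕ
  card S = length (elems S)

  -- the character χ_a(x) = e^{2πi (a·x)/p} = ζ^{a·x}
  χ : Pt p d → Pt p d → Cyc p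
  χ a x = ζ^ (dot a x)

  -- |E| · ⟨χ_a|_E , χ_b|_E⟩_{L²(E)} = Σ_{x∈E} χ_a(x) conj(χ_b(x))
  innerSum : List (Pt p d) → Pt p d → Pt p d → Cyc p
  innerSum E a b = sumᶜ (List.map (λ x → χ a x *ᶜ conjᶜ (χ b x)) (elems E))

  -- E is spectral with spectrum A: the restricted characters χ_a|_E (a ∈ A)
  -- are pairwise orthogonal in L²(E) and there are dim L²(E) = |E| of them
  -- (pairwise orthogonal nonzero vectors, |E| many, form an orthogonal basis;
  -- each χ_a|_E is nonzero since |χ_a| = 1).
  Spectral : List (Pt p d) → List (Pt p d) → Set
  Spectral E A =
    card A ≡ card E ×
    (∀ a b → a ∈ A → b ∈ A → ¬ (a ≡ b) → innerSum E a b ≈ᶜ 0ᶜ)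

  Tiling : List (Pt p d) → Set
  Tiling E = ∃ λ (T : List (Pt p d)) →
    (∀ x → ∃ λ e → ∃ λ t → e ∈ E × t ∈ T × e ⊕ t ≡ x) ×
    (∀ e e' t t' → e ∈ E → e' ∈ E → t ∈ T → t' ∈ T →
       e ⊕ t ≡ e' ⊕ t' → t ≡ t')

module _ {p : ℕ} .{{_ : NonZero p}} where

  Eset : ZMod p → List (Pt p 4)
  Eset n =
    List.map (λ t → t *ₚ t ∷ t ∷ t ∷ [ 1 ]ₚ ∷ []) (allFin p) ++
    List.map (λ t → n *ₚ (t *ₚ t) ∷ n *ₚ t ∷ t ∷ n ∷ []) (allFin p)

  Aset : ZMod p → List (Pt p 4)
  Aset n =
    List.map (λ i → [ 1 ]ₚ ∷ [ 2 ]ₚ *ₚ i ∷ [ 0 ]ₚ ∷ i *ₚ i ∷ []) (allFin p) ++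
    List.map (λ i → [ 0 ]ₚ ∷ [ 0 ]ₚ ∷ -ₚ ([ 2 ]ₚ *ₚ n *ₚ i) ∷ n *ₚ (i *ₚ i) ∷ [])
             (allFin p)

{-# OPTIONS --safe #-}
-- For a ≠ b in A, |E| ⟨χ_a, χ_b⟩ = Σ_k N_k ζ^k, where N_k is the number of x ∈ E with
-- a·x − b·x = k; since 1 + ζ + … + ζ^(p−1) = 0 this vanishes once N_k is constant in k.
-- Along each of the two parabolas making up E the phase a·x − b·x is, as a function of
-- the parameter t, affine with nonzero slope when a and b come from the same family of A,
-- and of the form (t + β)² + c, resp. n (t + γ)² + c, otherwise.  Hence N_k ≤ 2 for all k
-- (in the quadratic case because (t + β)² = n (s + γ)² ≠ 0 would make n a square), and as
-- Σ_k N_k = |E| = 2p, every N_k equals 2.  A tiling would make |E| = 2p divide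
-- |(ℤ/pℤ)⁴| = p⁴, impossible for odd p.  Non-squares exist because squaring is not
-- injective on ℤ/pℤ: 1² = (−1)².
module Submission where

open import Defs
open import Data.Nat using (ℕ; NonZero; _*_; _^_; _≤_; z≤n; s≤s)
open import Data.Nat.Primality using (Prime; euclidsLemma; prime⇒irreducible; prime[2]; ¬prime[1])
open import Data.List
  using (List; []; _∷_; [_]; _++_; map; length; filter; allFin; foldr; deduplicate;
         cartesianProduct; cartesianProductWith)
open import Data.Product using (_×_; ∃; _,_; proj₁; proj₂)
open import Relation.Binary.PropositionalEquality
  using (_≡_; _≢_; refl; sym; trans; cong; cong₂; subst; isEquivalence; module ≡-Reasoning)
open import Relation.Nullary using (¬_; ¬?; Dec; yes; no; does; contradiction)

open import Algebra.Bundles using (CommutativeRing)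
open import Algebra.Structures using (IsCommutativeRing)
open import Data.Bool using (true; false)
open import Data.Fin using (Fin; toℕ; punchOut; #_)
open import Data.Fin.Properties
  using (toℕ-injective; toℕ-fromℕ<; toℕ<n; any?; all?; ¬∀⟶∃¬; punchOut-injective; injective⇒≤)
  renaming (_≟_ to _≟ᶠ_)
open import Data.Integer as ℤ using (ℤ; +_; -[1+_])
import Data.Integer.Properties as ℤ
open import Data.List.Properties
  using (filter-++; filter-none; filter-some; filter-all; filter-≐; length-++; length-map;
         length-tabulate; map-cong)
open import Data.List.Membership.Propositional using (_∈_; _∉_)
open import Data.List.Membership.Propositional.Properties
  using (∈-allFin; ∈-map⁺; ∈-map⁻; ∈-++⁻; ∈-cartesianProductWith⁺; ∈-cartesianProduct⁺;
         ∈-cartesianProduct⁻; ∈-deduplicate⁺; ∈-deduplicate⁻)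
open import Data.List.Membership.Propositional.Properties.WithK using (unique∧set⇒bag)
open import Data.List.Relation.Binary.BagAndSetEquality using (∼bag⇒↭)
open import Data.List.Relation.Binary.Permutation.Propositional.Properties using (↭-length)
open import Data.List.Relation.Unary.All as All using (All)
import Data.List.Relation.Unary.All.Properties as Allₚ
open import Data.List.Relation.Unary.AllPairs using ([]; _∷_)
open import Data.List.Relation.Unary.Any using (here; there)
open import Data.List.Relation.Unary.Unique.Propositional using (Unique)
open import Data.List.Relation.Unary.Unique.Propositional.Properties
  using (allFin⁺; cartesianProduct⁺; cartesianProductWith⁺; map⁺; ++⁺)
open import Data.List.Relation.Unary.Unique.DecPropositional.Properties using (deduplicate-!)
open import Data.Maybe using (Maybe; just; nothing)
import Data.Nat as ℕ
import Data.Nat.Properties as ℕ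
open import Data.Nat.DivMod using (_%_; m<n⇒m%n≡m; %-distribˡ-+; %-distribˡ-*; n%n≡0)
open import Data.Nat.Divisibility
  using (_∣_; divides; ∣-trans; m∣m*n; m%n≡0⇒n∣m; n∣m⇒m%n≡0; ∣1⇒≡1)
open import Data.Nat.ListAction using (sum)
open import Data.Sign as Sign using (Sign)
open import Data.Sum as Sum using (_⊎_; inj₁; inj₂)
import Data.Vec as Vec
open import Data.Vec using (Vec; []; _∷_)
import Data.Vec.Properties as Vecₚ
open import Function.Base using (id; _∘_)
open import Function.Bundles using (mk⇔)
open import Function.Definitions using (Injective)
open import Relation.Binary using (REL; DecidableEquality) renaming (Decidable to Decidable₂)
open import Relation.Unary using (Pred; Decidable; ∁)

+-≤-pinch : ∀ {m n o q} → m ≤ o → n ≤ q → m ℕ.+ n ≡ o ℕ.+ q → m ≡ o × n ≡ q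
+-≤-pinch {m} {n} {o} {q} m≤o n≤q m+n≡o+q =
  m≡o , ℕ.+-cancelˡ-≡ m n q (trans m+n≡o+q (cong (ℕ._+ q) (sym m≡o)))
  where
  m≡o : m ≡ o
  m≡o = ℕ.≤-antisym m≤o
    (ℕ.+-cancelʳ-≤ q o m (ℕ.≤-trans (ℕ.≤-reflexive (sym m+n≡o+q)) (ℕ.+-monoʳ-≤ m n≤q)))

prime≢2⇒2∤^ : ∀ {p} → Prime p → p ≢ 2 → ∀ k → ¬ 2 ∣ p ^ k
prime≢2⇒2∤^     p-prime p≢2 ℕ.zero    2∣1     = contradiction (∣1⇒≡1 2∣1) λ ()
prime≢2⇒2∤^ {p} p-prime p≢2 (ℕ.suc k) 2∣p^1+k =
  Sum.[ 2∤p , prime≢2⇒2∤^ p-prime p≢2 k ] (euclidsLemma p (p ^ k) prime[2] 2∣p^1+k)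
  where
  2∤p : ¬ 2 ∣ p
  2∤p 2∣p with prime⇒irreducible p-prime 2∣p
  ... | inj₂ 2≡p = p≢2 (sym 2≡p)

module _ {a} {A : Set a} where

  sum-map-+ : ∀ (f g : A → ℕ) xs → sum (map (λ x → f x ℕ.+ g x) xs) ≡ sum (map f xs) ℕ.+ sum (map g xs)
  sum-map-+ f g []       = refl
  sum-map-+ f g (x ∷ xs) =
    trans (cong (f x ℕ.+ g x ℕ.+_) (sum-map-+ f g xs)) (interchange (f x) (g x) _ _)
    where open import Algebra.Properties.CommutativeSemigroup ℕ.+-commutativeSemigroup using (interchange)

  sum-map-≤ : ∀ {g : A → ℕ} {c} → (∀ x → g x ≤ c) → ∀ xs → sum (map g xs) ≤ c * length xs
  sum-map-≤ g≤c []       = z≤n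
  sum-map-≤ {g} {c} g≤c (x ∷ xs) = begin
    g x ℕ.+ sum (map g xs)  ≤⟨ ℕ.+-mono-≤ (g≤c x) (sum-map-≤ g≤c xs) ⟩
    c ℕ.+ c * length xs     ≡⟨ ℕ.*-suc c (length xs) ⟨
    c * ℕ.suc (length xs)   ∎
    where open ℕ.≤-Reasoning

  sum-map-≡ : ∀ {g : A → ℕ} {c} → (∀ x → g x ≡ c) → ∀ xs → sum (map g xs) ≡ c * length xs
  sum-map-≡ {c = c} g≡c [] = sym (ℕ.*-zeroʳ c)
  sum-map-≡ {g} {c} g≡c (x ∷ xs) = begin
    g x ℕ.+ sum (map g xs)  ≡⟨ cong₂ ℕ._+_ (g≡c x) (sum-map-≡ g≡c xs) ⟩
    c ℕ.+ c * length xs     ≡⟨ ℕ.*-suc c (length xs) ⟨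
    c * ℕ.suc (length xs)   ∎
    where open ≡-Reasoning

  maximal-sum⇒all-maximal : ∀ {g : A → ℕ} {c} → (∀ x → g x ≤ c) →
    ∀ xs → sum (map g xs) ≡ c * length xs → ∀ {x} → x ∈ xs → g x ≡ c
  maximal-sum⇒all-maximal {g} {c} g≤c (x ∷ xs) sum≡ x∈x∷xs
    with gx≡c , rest≡ ← +-≤-pinch (g≤c x) (sum-map-≤ g≤c xs) (trans sum≡ (ℕ.*-suc c (length xs)))
       | x∈x∷xs
  ... | here refl   = gx≡c
  ... | there x∈xs = maximal-sum⇒all-maximal g≤c xs rest≡ x∈xs

count : ∀ {a ℓ} {A : Set a} {P : Pred A ℓ} → Decidable P → List A → ℕ
count P? xs = length (filter P? xs)

module _ {a ℓ} {A : Set a} {P : Pred A ℓ} (P? : Decidable P) where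

  count-++ : ∀ xs ys → count P? (xs ++ ys) ≡ count P? xs ℕ.+ count P? ys
  count-++ xs ys = trans (cong length (filter-++ P? xs ys)) (length-++ (filter P? xs))

  count-map : ∀ {b} {B : Set b} (f : B → A) xs → count P? (map f xs) ≡ count (P? ∘ f) xs
  count-map f []       = refl
  count-map f (x ∷ xs) with does (P? (f x))
  ... | true  = cong ℕ.suc (count-map f xs)
  ... | false = count-map f xs

  count≡0 : ∀ {xs} → All (∁ P) xs → count P? xs ≡ 0
  count≡0 ¬Pxs = cong length (filter-none P? ¬Pxs)

  count≤1 : ∀ {xs} → Unique xs → (∀ {x y} → x ∈ xs → y ∈ xs → P x → P y → x ≡ y) →
            count P? xs ≤ 1
  count≤1 []              P-unique = z≤n
  count≤1 {x ∷ xs} (x∉xs ∷ xs!) P-unique with P? x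
  ... | yes Px = s≤s (ℕ.≤-reflexive (count≡0 (All.tabulate λ y∈xs Py →
                   All.lookup x∉xs y∈xs (P-unique (here refl) (there y∈xs) Px Py))))
  ... | no  _  = count≤1 xs! λ x∈xs y∈xs → P-unique (there x∈xs) (there y∈xs)

  count≤2 : ∀ {xs} (ρ : A → A) → Unique xs → (∀ {x y} → P x → P y → x ≡ y ⊎ x ≡ ρ y) →
            count P? xs ≤ 2
  count≤2 ρ []              P-2to1 = z≤n
  count≤2 {x ∷ xs} ρ (x∉xs ∷ xs!) P-2to1 with P? x
  ... | no  _  = count≤2 ρ xs! P-2to1
  ... | yes Px = s≤s (count≤1 xs! λ y∈xs y′∈xs Py Py′ →
                   trans (≡ρx y∈xs Py) (sym (≡ρx y′∈xs Py′)))
    where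
    ≡ρx : ∀ {y} → y ∈ xs → P y → y ≡ ρ x
    ≡ρx y∈xs Py = Sum.[ (λ y≡x → contradiction (sym y≡x) (All.lookup x∉xs y∈xs)) , id ] (P-2to1 Py Px)

module _ {a b ℓ} {A : Set a} {B : Set b} {R : REL A B ℓ} (R? : Decidable₂ R) where

  double-counting : ∀ xs ys →
    sum (map (λ y → count (λ x → R? x y) xs) ys) ≡ sum (map (λ x → count (R? x) ys) xs)
  double-counting []       ys = sum-map-≡ (λ _ → refl) ys
  double-counting (x ∷ xs) ys = begin
    sum (map (λ y → count (λ x′ → R? x′ y) (x ∷ xs)) ys)
      ≡⟨ cong sum (map-cong (λ y → count-++ (λ x′ → R? x′ y) [ x ] xs) ys) ⟩
    sum (map (λ y → count (λ x′ → R? x′ y) [ x ] ℕ.+ count (λ x′ → R? x′ y) xs) ys)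
      ≡⟨ sum-map-+ (λ y → count (λ x′ → R? x′ y) [ x ]) (λ y → count (λ x′ → R? x′ y) xs) ys ⟩
    sum (map (λ y → count (λ x′ → R? x′ y) [ x ]) ys) ℕ.+ sum (map (λ y → count (λ x′ → R? x′ y) xs) ys)
      ≡⟨ cong₂ ℕ._+_ (row ys) (double-counting xs ys) ⟩
    count (R? x) ys ℕ.+ sum (map (λ x′ → count (R? x′) ys) xs)
      ∎
    where
    open ≡-Reasoning
    row : ∀ ys → sum (map (λ y → count (λ x′ → R? x′ y) [ x ]) ys) ≡ count (R? x) ys
    row []       = refl
    row (y ∷ ys) with does (R? x y)
    ... | true  = cong ℕ.suc (row ys)
    ... | false = row ys

count-≟-allFin≡1 : ∀ {n} (z : Fin n) → count (z ≟ᶠ_) (allFin n) ≡ 1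
count-≟-allFin≡1 {n} z = ℕ.≤-antisym
  (count≤1 (z ≟ᶠ_) (allFin⁺ n) λ _ _ z≡x z≡y → trans (sym z≡x) z≡y)
  (filter-some (z ≟ᶠ_) (∈-allFin z))

module _ {a} {A : Set a} {n} (f : A → Fin n) where

  fibre-size : List A → Fin n → ℕ
  fibre-size xs y = count (λ x → f x ≟ᶠ y) xs

  fibre-size-cong : ∀ {g : A → Fin n} {k k′} xs → (∀ {x} → f x ≡ k → g x ≡ k′) →
                    (∀ {x} → g x ≡ k′ → f x ≡ k) → fibre-size xs k ≡ count (λ x → g x ≟ᶠ k′) xs
  fibre-size-cong xs ⇒ ⇐ = cong length (filter-≐ _ _ (⇒ , ⇐) xs)

  fibres-partition : ∀ xs → sum (map (fibre-size xs) (allFin n)) ≡ length xs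
  fibres-partition xs = begin
    sum (map (fibre-size xs) (allFin n))             ≡⟨ double-counting (λ x y → f x ≟ᶠ y) xs (allFin n) ⟩
    sum (map (λ x → count (f x ≟ᶠ_) (allFin n)) xs)  ≡⟨ sum-map-≡ (λ x → count-≟-allFin≡1 (f x)) xs ⟩
    1 * length xs                                    ≡⟨ ℕ.*-identityˡ (length xs) ⟩
    length xs                                        ∎
    where open ≡-Reasoning

  fibres≤c⇒fibres≡c : ∀ {c} xs → (∀ y → fibre-size xs y ≤ c) → length xs ≡ c * n →
                      ∀ y → fibre-size xs y ≡ c
  fibres≤c⇒fibres≡c {c} xs fibre≤c length≡ y =
    maximal-sum⇒all-maximal fibre≤c (allFin n) sum≡ (∈-allFin y)
    where
    sum≡ : sum (map (fibre-size xs) (allFin n)) ≡ c * length (allFin n)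
    sum≡ = trans (fibres-partition xs) (trans length≡ (cong (c *_) (sym (length-tabulate id))))

length-cartesianProductWith : ∀ {a b c} {A : Set a} {B : Set b} {C : Set c} (f : A → B → C) xs ys →
  length (cartesianProductWith f xs ys) ≡ length xs * length ys
length-cartesianProductWith f []       ys = refl
length-cartesianProductWith f (x ∷ xs) ys = trans (length-++ (map (f x) ys))
  (cong₂ ℕ._+_ (length-map (f x) ys) (length-cartesianProductWith f xs ys))

module _ {a b} {A : Set a} {B : Set b} where

  map⁺-injectiveOn : ∀ {f : A → B} {xs} → Unique xs →
    (∀ {x y} → x ∈ xs → y ∈ xs → f x ≡ f y → x ≡ y) → Unique (map f xs)
  map⁺-injectiveOn []           f-inj = []
  map⁺-injectiveOn (x∉xs ∷ xs!) f-inj =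
    Allₚ.map⁺ (All.tabulate λ y∈xs fx≡fy → All.lookup x∉xs y∈xs (f-inj (here refl) (there y∈xs) fx≡fy))
    ∷ map⁺-injectiveOn xs! λ x∈xs y∈xs → f-inj (there x∈xs) (there y∈xs)

Unique∧same-elements⇒length≡ : ∀ {a} {A : Set a} {xs ys : List A} → Unique xs → Unique ys →
  (∀ {z} → z ∈ xs → z ∈ ys) → (∀ {z} → z ∈ ys → z ∈ xs) → length xs ≡ length ys
Unique∧same-elements⇒length≡ xs! ys! xs⊆ys ys⊆xs =
  ↭-length (∼bag⇒↭ (unique∧set⇒bag xs! ys! (mk⇔ xs⊆ys ys⊆xs)))

deduplicate-Unique : ∀ {a} {A : Set a} (_≟_ : DecidableEquality A) {xs} → Unique xs →
                     deduplicate _≟_ xs ≡ xs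
deduplicate-Unique _≟_ []                    = refl
deduplicate-Unique _≟_ {x ∷ xs} (x∉xs ∷ xs!) = cong (x ∷_) (begin
  filter (¬? ∘ (x ≟_)) (deduplicate _≟_ xs)  ≡⟨ cong (filter (¬? ∘ (x ≟_))) (deduplicate-Unique _≟_ xs!) ⟩
  filter (¬? ∘ (x ≟_)) xs                    ≡⟨ filter-all (¬? ∘ (x ≟_)) x∉xs ⟩
  xs                                         ∎)
  where open ≡-Reasoning

injective⇒surjective : ∀ {n} (f : Fin n → Fin n) → Injective _≡_ _≡_ f →
                       ∀ y → ∃ λ x → f x ≡ y
injective⇒surjective {ℕ.suc n} f f-injective y with any? (λ x → f x ≟ᶠ y)
... | yes hit  = hit
... | no  miss = contradiction (injective⇒≤ g-injective) (ℕ.<-irrefl refl)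
  where
  -- f misses y, so it factors through Fin n, contradicting the pigeonhole principle
  g : Fin (ℕ.suc n) → Fin n
  g x = punchOut {i = y} {j = f x} λ y≡fx → miss (x , sym y≡fx)

  g-injective : Injective _≡_ _≡_ g
  g-injective gx≡gx′ = f-injective (punchOut-injective {i = y} _ _ gx≡gx′)

module ZModRing (p : ℕ) .{{_ : NonZero p}} where

  open ≡-Reasoning

  0ₚ 1ₚ 2ₚ : ZMod p
  0ₚ = [ 0 ]ₚ
  1ₚ = [ 1 ]ₚ
  2ₚ = [ 2 ]ₚ

  0%p≡0 : 0 % p ≡ 0
  0%p≡0 = m<n⇒m%n≡m (ℕ.>-nonZero⁻¹ p)

  toℕ-[]ₚ : ∀ m → toℕ {p} [ m ]ₚ ≡ m % p
  toℕ-[]ₚ m = toℕ-fromℕ< _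

  []ₚ-cong : ∀ {m n} → m % p ≡ n % p → [ m ]ₚ ≡ [ n ]ₚ
  []ₚ-cong {m} {n} eq = toℕ-injective (trans (toℕ-[]ₚ m) (trans eq (sym (toℕ-[]ₚ n))))

  [toℕ]ₚ : (a : ZMod p) → [ toℕ a ]ₚ ≡ a
  [toℕ]ₚ a = toℕ-injective (trans (toℕ-[]ₚ (toℕ a)) (m<n⇒m%n≡m (toℕ<n a)))

  []ₚ-+ : ∀ m n → [ m ]ₚ +ₚ [ n ]ₚ ≡ [ m ℕ.+ n ]ₚ
  []ₚ-+ m n = []ₚ-cong (begin
    (toℕ [ m ]ₚ ℕ.+ toℕ [ n ]ₚ) % p  ≡⟨ cong₂ (λ x y → (x ℕ.+ y) % p) (toℕ-[]ₚ m) (toℕ-[]ₚ n) ⟩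
    (m % p ℕ.+ n % p) % p            ≡⟨ %-distribˡ-+ m n p ⟨
    (m ℕ.+ n) % p                    ∎)

  []ₚ-* : ∀ m n → [ m ]ₚ *ₚ [ n ]ₚ ≡ [ m * n ]ₚ
  []ₚ-* m n = []ₚ-cong (begin
    (toℕ [ m ]ₚ * toℕ [ n ]ₚ) % p  ≡⟨ cong₂ (λ x y → (x * y) % p) (toℕ-[]ₚ m) (toℕ-[]ₚ n) ⟩
    (m % p * (n % p)) % p          ≡⟨ %-distribˡ-* m n p ⟨
    (m * n) % p                    ∎)

  -- Every element is a class [ m ]ₚ, so identities can be checked on classes.
  elim₃ : {P : ZMod p → ZMod p → ZMod p → Set} →
          ∀ a b c → (∀ m n k → P [ m ]ₚ [ n ]ₚ [ k ]ₚ) → P a b c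
  elim₃ {P} a b c P[] =
    subst (λ c → P a b c) ([toℕ]ₚ c) (subst (λ b → P a b _) ([toℕ]ₚ b)
      (subst (λ a → P a _ _) ([toℕ]ₚ a) (P[] (toℕ a) (toℕ b) (toℕ c))))

  +ₚ-assoc : ∀ a b c → (a +ₚ b) +ₚ c ≡ a +ₚ (b +ₚ c)
  +ₚ-assoc a b c = elim₃ a b c λ m n k → begin
    ([ m ]ₚ +ₚ [ n ]ₚ) +ₚ [ k ]ₚ  ≡⟨ cong (_+ₚ [ k ]ₚ) ([]ₚ-+ m n) ⟩
    [ m ℕ.+ n ]ₚ +ₚ [ k ]ₚ        ≡⟨ []ₚ-+ (m ℕ.+ n) k ⟩
    [ m ℕ.+ n ℕ.+ k ]ₚ            ≡⟨ cong [_]ₚ (ℕ.+-assoc m n k) ⟩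
    [ m ℕ.+ (n ℕ.+ k) ]ₚ          ≡⟨ []ₚ-+ m (n ℕ.+ k) ⟨
    [ m ]ₚ +ₚ [ n ℕ.+ k ]ₚ        ≡⟨ cong ([ m ]ₚ +ₚ_) ([]ₚ-+ n k) ⟨
    [ m ]ₚ +ₚ ([ n ]ₚ +ₚ [ k ]ₚ)  ∎

  *ₚ-assoc : ∀ a b c → (a *ₚ b) *ₚ c ≡ a *ₚ (b *ₚ c)
  *ₚ-assoc a b c = elim₃ a b c λ m n k → begin
    ([ m ]ₚ *ₚ [ n ]ₚ) *ₚ [ k ]ₚ  ≡⟨ cong (_*ₚ [ k ]ₚ) ([]ₚ-* m n) ⟩
    [ m * n ]ₚ *ₚ [ k ]ₚ          ≡⟨ []ₚ-* (m * n) k ⟩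
    [ m * n * k ]ₚ                ≡⟨ cong [_]ₚ (ℕ.*-assoc m n k) ⟩
    [ m * (n * k) ]ₚ              ≡⟨ []ₚ-* m (n * k) ⟨
    [ m ]ₚ *ₚ [ n * k ]ₚ          ≡⟨ cong ([ m ]ₚ *ₚ_) ([]ₚ-* n k) ⟨
    [ m ]ₚ *ₚ ([ n ]ₚ *ₚ [ k ]ₚ)  ∎

  *ₚ-distribʳ : ∀ a b c → (b +ₚ c) *ₚ a ≡ b *ₚ a +ₚ c *ₚ a
  *ₚ-distribʳ a b c = elim₃ a b c λ m n k → begin
    ([ n ]ₚ +ₚ [ k ]ₚ) *ₚ [ m ]ₚ          ≡⟨ cong (_*ₚ [ m ]ₚ) ([]ₚ-+ n k) ⟩
    [ n ℕ.+ k ]ₚ *ₚ [ m ]ₚ                ≡⟨ []ₚ-* (n ℕ.+ k) m ⟩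
    [ (n ℕ.+ k) * m ]ₚ                    ≡⟨ cong [_]ₚ (ℕ.*-distribʳ-+ m n k) ⟩
    [ n * m ℕ.+ k * m ]ₚ                  ≡⟨ []ₚ-+ (n * m) (k * m) ⟨
    [ n * m ]ₚ +ₚ [ k * m ]ₚ              ≡⟨ cong₂ _+ₚ_ ([]ₚ-* n m) ([]ₚ-* k m) ⟨
    [ n ]ₚ *ₚ [ m ]ₚ +ₚ [ k ]ₚ *ₚ [ m ]ₚ  ∎

  +ₚ-comm : ∀ a b → a +ₚ b ≡ b +ₚ a
  +ₚ-comm a b = cong [_]ₚ (ℕ.+-comm (toℕ a) (toℕ b))

  *ₚ-comm : ∀ a b → a *ₚ b ≡ b *ₚ a
  *ₚ-comm a b = cong [_]ₚ (ℕ.*-comm (toℕ a) (toℕ b))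

  +ₚ-identityˡ : ∀ a → 0ₚ +ₚ a ≡ a
  +ₚ-identityˡ a = begin
    0ₚ +ₚ a           ≡⟨ cong (0ₚ +ₚ_) ([toℕ]ₚ a) ⟨
    0ₚ +ₚ [ toℕ a ]ₚ  ≡⟨ []ₚ-+ 0 (toℕ a) ⟩
    [ toℕ a ]ₚ        ≡⟨ [toℕ]ₚ a ⟩
    a                 ∎

  *ₚ-identityˡ : ∀ a → 1ₚ *ₚ a ≡ a
  *ₚ-identityˡ a = begin
    1ₚ *ₚ a           ≡⟨ cong (1ₚ *ₚ_) ([toℕ]ₚ a) ⟨
    1ₚ *ₚ [ toℕ a ]ₚ  ≡⟨ []ₚ-* 1 (toℕ a) ⟩
    [ 1 * toℕ a ]ₚ    ≡⟨ cong [_]ₚ (ℕ.*-identityˡ (toℕ a)) ⟩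
    [ toℕ a ]ₚ        ≡⟨ [toℕ]ₚ a ⟩
    a                 ∎

  -ₚ‿inverseˡ : ∀ a → (-ₚ a) +ₚ a ≡ 0ₚ
  -ₚ‿inverseˡ a = begin
    (-ₚ a) +ₚ a                     ≡⟨ cong ((-ₚ a) +ₚ_) ([toℕ]ₚ a) ⟨
    [ p ℕ.∸ toℕ a ]ₚ +ₚ [ toℕ a ]ₚ  ≡⟨ []ₚ-+ (p ℕ.∸ toℕ a) (toℕ a) ⟩
    [ p ℕ.∸ toℕ a ℕ.+ toℕ a ]ₚ      ≡⟨ cong [_]ₚ (ℕ.m∸n+n≡m (ℕ.<⇒≤ (toℕ<n a))) ⟩
    [ p ]ₚ                          ≡⟨ []ₚ-cong (trans (n%n≡0 p) (sym 0%p≡0)) ⟩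
    0ₚ                              ∎

  +ₚ-*ₚ-isCommutativeRing : IsCommutativeRing _≡_ _+ₚ_ _*ₚ_ (-ₚ_) 0ₚ 1ₚ
  +ₚ-*ₚ-isCommutativeRing = record
    { isRing = record
      { +-isAbelianGroup = record
        { isGroup = record
          { isMonoid = record
            { isSemigroup = record
              { isMagma = record { isEquivalence = isEquivalence ; ∙-cong = cong₂ _+ₚ_ }
              ; assoc = +ₚ-assoc }
            ; identity = comm∧idˡ⇒id +ₚ-comm +ₚ-identityˡ }
          ; inverse = comm∧invˡ⇒inv +ₚ-comm -ₚ‿inverseˡ
          ; ⁻¹-cong = cong (-ₚ_) }
        ; comm = +ₚ-comm }
      ; *-cong = cong₂ _*ₚ_
      ; *-assoc = *ₚ-assoc
      ; *-identity = comm∧idˡ⇒id *ₚ-comm *ₚ-identityˡ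
      ; distrib = comm∧distrʳ⇒distrˡ *ₚ-comm *ₚ-distribʳ , *ₚ-distribʳ }
    ; *-comm = *ₚ-comm }
    where open import Algebra.Consequences.Propositional {A = ZMod p}

  commutativeRing : CommutativeRing _ _
  commutativeRing = record { isCommutativeRing = +ₚ-*ₚ-isCommutativeRing }

  open CommutativeRing commutativeRing public
    using (+-identityˡ; +-identityʳ; -‿inverseʳ; +-assoc; +-comm; *-identityˡ; ring)
  open import Algebra.Properties.Ring ring public
    using (-0#≈0#; -‿involutive; -‿injective; -‿+-comm; -‿distribˡ-*; -‿distribʳ-*; +-cancelʳ;
           x∙y⁻¹≈ε⇒x≈y; x≈z//y; //-rightDividesˡ)
  open import Algebra.Properties.CommutativeSemigroup
    (CommutativeRing.+-commutativeSemigroup commutativeRing) using (interchange)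

  fromℤ : ℤ → ZMod p
  fromℤ (+ n)    = [ n ]ₚ
  fromℤ -[1+ n ] = -ₚ [ ℕ.suc n ]ₚ

  fromℤ-⊖ : ∀ m n → fromℤ (m ℤ.⊖ n) ≡ [ m ]ₚ -ₚ [ n ]ₚ
  fromℤ-⊖ m         ℕ.zero    = sym (trans (cong ([ m ]ₚ +ₚ_) -0#≈0#) (+-identityʳ [ m ]ₚ))
  fromℤ-⊖ ℕ.zero    (ℕ.suc n) = sym (+-identityˡ _)
  fromℤ-⊖ (ℕ.suc m) (ℕ.suc n) = begin
    fromℤ (ℕ.suc m ℤ.⊖ ℕ.suc n)            ≡⟨ cong fromℤ (ℤ.[1+m]⊖[1+n]≡m⊖n m n) ⟩
    fromℤ (m ℤ.⊖ n)                        ≡⟨ fromℤ-⊖ m n ⟩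
    [ m ]ₚ -ₚ [ n ]ₚ                       ≡⟨ +-identityˡ _ ⟨
    0ₚ +ₚ ([ m ]ₚ -ₚ [ n ]ₚ)               ≡⟨ cong (_+ₚ ([ m ]ₚ -ₚ [ n ]ₚ)) (-‿inverseʳ 1ₚ) ⟨
    (1ₚ -ₚ 1ₚ) +ₚ ([ m ]ₚ -ₚ [ n ]ₚ)       ≡⟨ interchange 1ₚ (-ₚ 1ₚ) [ m ]ₚ (-ₚ [ n ]ₚ) ⟩
    (1ₚ +ₚ [ m ]ₚ) +ₚ ((-ₚ 1ₚ) -ₚ [ n ]ₚ)  ≡⟨ cong₂ _+ₚ_ ([]ₚ-+ 1 m) (-‿+-comm 1ₚ [ n ]ₚ) ⟩
    [ ℕ.suc m ]ₚ -ₚ (1ₚ +ₚ [ n ]ₚ)         ≡⟨ cong (λ x → [ ℕ.suc m ]ₚ -ₚ x) ([]ₚ-+ 1 n) ⟩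
    [ ℕ.suc m ]ₚ -ₚ [ ℕ.suc n ]ₚ           ∎

  fromℤ-+ : ∀ i j → fromℤ (i ℤ.+ j) ≡ fromℤ i +ₚ fromℤ j
  fromℤ-+ (+ m)    (+ n)    = sym ([]ₚ-+ m n)
  fromℤ-+ (+ m)    -[1+ n ] = fromℤ-⊖ m (ℕ.suc n)
  fromℤ-+ -[1+ m ] (+ n)    = trans (fromℤ-⊖ n (ℕ.suc m)) (+-comm [ n ]ₚ _)
  fromℤ-+ -[1+ m ] -[1+ n ] = begin
    -ₚ [ ℕ.suc (ℕ.suc (m ℕ.+ n)) ]ₚ    ≡⟨ cong (λ k → -ₚ [ ℕ.suc k ]ₚ) (ℕ.+-suc m n) ⟨
    -ₚ [ ℕ.suc m ℕ.+ ℕ.suc n ]ₚ        ≡⟨ cong -ₚ_ ([]ₚ-+ (ℕ.suc m) (ℕ.suc n)) ⟨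
    -ₚ ([ ℕ.suc m ]ₚ +ₚ [ ℕ.suc n ]ₚ)  ≡⟨ -‿+-comm [ ℕ.suc m ]ₚ [ ℕ.suc n ]ₚ ⟨
    (-ₚ [ ℕ.suc m ]ₚ) -ₚ [ ℕ.suc n ]ₚ  ∎

  signed : Sign → ZMod p → ZMod p
  signed Sign.+ x = x
  signed Sign.- x = -ₚ x

  fromℤ-◃ : ∀ s n → fromℤ (s ℤ.◃ n) ≡ signed s [ n ]ₚ
  fromℤ-◃ Sign.+ ℕ.zero    = refl
  fromℤ-◃ Sign.- ℕ.zero    = sym -0#≈0#
  fromℤ-◃ Sign.+ (ℕ.suc n) = refl
  fromℤ-◃ Sign.- (ℕ.suc n) = refl

  fromℤ-sign-abs : ∀ i → fromℤ i ≡ signed (ℤ.sign i) [ ℤ.∣ i ∣ ]ₚ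
  fromℤ-sign-abs (+ n)    = refl
  fromℤ-sign-abs -[1+ n ] = refl

  signed-* : ∀ s t x y → signed (s Sign.* t) (x *ₚ y) ≡ signed s x *ₚ signed t y
  signed-* Sign.+ Sign.+ x y = refl
  signed-* Sign.+ Sign.- x y = -‿distribʳ-* x y
  signed-* Sign.- Sign.+ x y = -‿distribˡ-* x y
  signed-* Sign.- Sign.- x y = begin
    x *ₚ y            ≡⟨ -‿involutive (x *ₚ y) ⟨
    -ₚ (-ₚ (x *ₚ y))  ≡⟨ cong -ₚ_ (-‿distribʳ-* x y) ⟩
    -ₚ (x *ₚ (-ₚ y))  ≡⟨ -‿distribˡ-* x (-ₚ y) ⟩
    (-ₚ x) *ₚ (-ₚ y)  ∎

  fromℤ-* : ∀ i j → fromℤ (i ℤ.* j) ≡ fromℤ i *ₚ fromℤ j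
  fromℤ-* i j = begin
    fromℤ (s Sign.* t ℤ.◃ ℤ.∣ i ∣ * ℤ.∣ j ∣)
      ≡⟨ fromℤ-◃ (s Sign.* t) _ ⟩
    signed (s Sign.* t) [ ℤ.∣ i ∣ * ℤ.∣ j ∣ ]ₚ
      ≡⟨ cong (signed (s Sign.* t)) ([]ₚ-* ℤ.∣ i ∣ ℤ.∣ j ∣) ⟨
    signed (s Sign.* t) ([ ℤ.∣ i ∣ ]ₚ *ₚ [ ℤ.∣ j ∣ ]ₚ)
      ≡⟨ signed-* s t _ _ ⟩
    signed s [ ℤ.∣ i ∣ ]ₚ *ₚ signed t [ ℤ.∣ j ∣ ]ₚ
      ≡⟨ cong₂ _*ₚ_ (fromℤ-sign-abs i) (fromℤ-sign-abs j) ⟨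
    fromℤ i *ₚ fromℤ j
      ∎
    where s = ℤ.sign i; t = ℤ.sign j

  fromℤ-neg : ∀ i → fromℤ (ℤ.- i) ≡ -ₚ fromℤ i
  fromℤ-neg (+ ℕ.zero)  = sym -0#≈0#
  fromℤ-neg (+ ℕ.suc n) = refl
  fromℤ-neg -[1+ n ]    = sym (-‿involutive _)

  -- The ring solver for ℤ/pℤ with integer coefficients, so that constants
  -- such as 2 = fromℤ (+ 2) can appear in the identities.
  module Solver where
    open import Algebra.Solver.Ring.AlmostCommutativeRing
      using (fromCommutativeRing; _-Raw-AlmostCommutative⟶_)

    fromℤ-homomorphism : ℤ.+-*-rawRing -Raw-AlmostCommutative⟶ fromCommutativeRing commutativeRing
    fromℤ-homomorphism = record
      { ⟦_⟧ = fromℤ ; +-homo = fromℤ-+ ; *-homo = fromℤ-* ; -‿homo = fromℤ-neg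
      ; 0-homo = refl ; 1-homo = refl }

    fromℤ-≟ : ∀ i j → Maybe (fromℤ i ≡ fromℤ j)
    fromℤ-≟ i j with i ℤ.≟ j
    ... | yes i≡j = just (cong fromℤ i≡j)
    ... | no  _   = nothing

    open import Algebra.Solver.Ring ℤ.+-*-rawRing (fromCommutativeRing commutativeRing)
      fromℤ-homomorphism fromℤ-≟ public

  module _ {a} {A : Set a} {f g : A → ZMod p} where

    fibre-size-+ : ∀ c xs k → (∀ x → f x ≡ g x +ₚ c) → fibre-size f xs k ≡ fibre-size g xs (k -ₚ c)
    fibre-size-+ c xs k f≡g+c = fibre-size-cong f xs
      (λ {x} fx≡k → x≈z//y (g x) c k (trans (sym (f≡g+c x)) fx≡k))
      (λ {x} gx≡k-c → trans (f≡g+c x) (trans (cong (_+ₚ c) gx≡k-c) (//-rightDividesˡ c k)))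

    fibre-size-neg : ∀ xs k → (∀ x → f x ≡ -ₚ g x) → fibre-size f xs k ≡ fibre-size g xs (-ₚ k)
    fibre-size-neg xs k f≡-g = fibre-size-cong f xs
      (λ {x} fx≡k → trans (sym (-‿involutive (g x))) (cong -ₚ_ (trans (sym (f≡-g x)) fx≡k)))
      (λ {x} gx≡-k → trans (f≡-g x) (trans (cong -ₚ_ gx≡-k) (-‿involutive k)))

module PrimeField (p : ℕ) .{{_ : NonZero p}} (p-prime : Prime p) where

  open ZModRing p
  open Solver using (solve; _:+_; _:*_; _:-_; :-_; _:=_; con)
  open ≡-Reasoning

  []ₚ≡0ₚ⇒∣ : ∀ m → [ m ]ₚ ≡ 0ₚ → p ∣ m
  []ₚ≡0ₚ⇒∣ m eq = m%n≡0⇒n∣m m p (begin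
    m % p       ≡⟨ toℕ-[]ₚ m ⟨
    toℕ [ m ]ₚ  ≡⟨ cong toℕ eq ⟩
    toℕ 0ₚ      ≡⟨ toℕ-[]ₚ 0 ⟩
    0 % p       ≡⟨ 0%p≡0 ⟩
    0           ∎)

  ∣toℕ⇒≡0ₚ : ∀ a → p ∣ toℕ a → a ≡ 0ₚ
  ∣toℕ⇒≡0ₚ a p∣a = trans (sym ([toℕ]ₚ a)) ([]ₚ-cong (trans (n∣m⇒m%n≡0 _ p p∣a) (sym 0%p≡0)))

  x*y≡0⇒x≡0⊎y≡0 : ∀ {x y} → x *ₚ y ≡ 0ₚ → x ≡ 0ₚ ⊎ y ≡ 0ₚ
  x*y≡0⇒x≡0⊎y≡0 {x} {y} xy≡0 =
    Sum.map (∣toℕ⇒≡0ₚ x) (∣toℕ⇒≡0ₚ y) (euclidsLemma (toℕ x) (toℕ y) p-prime ([]ₚ≡0ₚ⇒∣ _ xy≡0))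

  x≢0∧y≢0⇒x*y≢0 : ∀ {x y} → x ≢ 0ₚ → y ≢ 0ₚ → x *ₚ y ≢ 0ₚ
  x≢0∧y≢0⇒x*y≢0 x≢0 y≢0 xy≡0 = Sum.[ x≢0 , y≢0 ] (x*y≡0⇒x≡0⊎y≡0 xy≡0)

  x*x≡0⇒x≡0 : ∀ {x} → x *ₚ x ≡ 0ₚ → x ≡ 0ₚ
  x*x≡0⇒x≡0 {x} xx≡0 = Sum.[ id , id ] (x*y≡0⇒x≡0⊎y≡0 {x} {x} xx≡0)

  x-y≡0⇒x≡y : ∀ {x y} → x -ₚ y ≡ 0ₚ → x ≡ y
  x-y≡0⇒x≡y = x∙y⁻¹≈ε⇒x≈y _ _

  x≢y⇒x-y≢0 : ∀ {x y} → x ≢ y → x -ₚ y ≢ 0ₚ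
  x≢y⇒x-y≢0 x≢y = x≢y ∘ x-y≡0⇒x≡y

  *ₚ-cancelˡ : ∀ {c x y} → c ≢ 0ₚ → c *ₚ x ≡ c *ₚ y → x ≡ y
  *ₚ-cancelˡ {c} {x} {y} c≢0 cx≡cy =
    x-y≡0⇒x≡y (Sum.[ (λ c≡0 → contradiction c≡0 c≢0) , id ] (x*y≡0⇒x≡0⊎y≡0 c[x-y]≡0))
    where
    c[x-y]≡0 : c *ₚ (x -ₚ y) ≡ 0ₚ
    c[x-y]≡0 = begin
      c *ₚ (x -ₚ y)     ≡⟨ solve 3 (λ c x y → c :* (x :- y) := c :* x :- c :* y) refl c x y ⟩
      c *ₚ x -ₚ c *ₚ y  ≡⟨ cong (_-ₚ c *ₚ y) cx≡cy ⟩
      c *ₚ y -ₚ c *ₚ y  ≡⟨ -‿inverseʳ (c *ₚ y) ⟩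
      0ₚ                ∎

  x*x≡y*y⇒x≡y⊎x≡-y : ∀ {x y} → x *ₚ x ≡ y *ₚ y → x ≡ y ⊎ x ≡ -ₚ y
  x*x≡y*y⇒x≡y⊎x≡-y {x} {y} xx≡yy = Sum.map x-y≡0⇒x≡y x+y≡0⇒x≡-y (x*y≡0⇒x≡0⊎y≡0 [x-y][x+y]≡0)
    where
    [x-y][x+y]≡0 : (x -ₚ y) *ₚ (x +ₚ y) ≡ 0ₚ
    [x-y][x+y]≡0 = begin
      (x -ₚ y) *ₚ (x +ₚ y)  ≡⟨ solve 2 (λ x y → (x :- y) :* (x :+ y) := x :* x :- y :* y) refl x y ⟩
      x *ₚ x -ₚ y *ₚ y      ≡⟨ cong (_-ₚ y *ₚ y) xx≡yy ⟩
      y *ₚ y -ₚ y *ₚ y      ≡⟨ -‿inverseʳ (y *ₚ y) ⟩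
      0ₚ                    ∎

    x+y≡0⇒x≡-y : x +ₚ y ≡ 0ₚ → x ≡ -ₚ y
    x+y≡0⇒x≡-y x+y≡0 = x-y≡0⇒x≡y (trans (cong (x +ₚ_) (-‿involutive y)) x+y≡0)

  *ₚ-inverse : ∀ {x} → x ≢ 0ₚ → ∃ λ y → x *ₚ y ≡ 1ₚ
  *ₚ-inverse x≢0 = injective⇒surjective _ (*ₚ-cancelˡ x≢0) 1ₚ

  p≢1 : p ≢ 1
  p≢1 p≡1 = ¬prime[1] (subst Prime p≡1 p-prime)

  1ₚ≢0ₚ : 1ₚ ≢ 0ₚ
  1ₚ≢0ₚ 1≡0 = p≢1 (∣1⇒≡1 ([]ₚ≡0ₚ⇒∣ 1 1≡0))

  2ₚ≢0ₚ : p ≢ 2 → 2ₚ ≢ 0ₚ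
  2ₚ≢0ₚ p≢2 2≡0 = Sum.[ p≢1 , p≢2 ] (prime⇒irreducible prime[2] ([]ₚ≡0ₚ⇒∣ 2 2≡0))

  IsSquare? : Decidable IsSquare
  IsSquare? n = any? λ x → x *ₚ x ≟ᶠ n

  ¬IsSquare⇒≢0 : ∀ {n} → ¬ IsSquare n → n ≢ 0ₚ
  ¬IsSquare⇒≢0 n-nonSquare refl = n-nonSquare (0ₚ , solve 0 (con (+ 0) :* con (+ 0) := con (+ 0)) refl)

  x*x≡n*y*y⇒IsSquare : ∀ {n x y} → y ≢ 0ₚ → x *ₚ x ≡ n *ₚ (y *ₚ y) → IsSquare n
  x*x≡n*y*y⇒IsSquare {n} {x} {y} y≢0 xx≡nyy = [x/y]² (*ₚ-inverse y≢0)
    where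
    [x/y]² : (∃ λ z → y *ₚ z ≡ 1ₚ) → IsSquare n
    [x/y]² (z , yz≡1) = x *ₚ z , (begin
      (x *ₚ z) *ₚ (x *ₚ z)
        ≡⟨ solve 2 (λ x z → (x :* z) :* (x :* z) := (x :* x) :* (z :* z)) refl x z ⟩
      (x *ₚ x) *ₚ (z *ₚ z)
        ≡⟨ cong (_*ₚ (z *ₚ z)) xx≡nyy ⟩
      n *ₚ (y *ₚ y) *ₚ (z *ₚ z)
        ≡⟨ solve 3 (λ n y z → n :* (y :* y) :* (z :* z) := n :* ((y :* z) :* (y :* z))) refl n y z ⟩
      n *ₚ ((y *ₚ z) *ₚ (y *ₚ z))
        ≡⟨ cong (λ u → n *ₚ (u *ₚ u)) yz≡1 ⟩
      n *ₚ (1ₚ *ₚ 1ₚ)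
        ≡⟨ solve 1 (λ n → n :* (con (+ 1) :* con (+ 1)) := n) refl n ⟩
      n
        ∎)

  1ₚ≢-1ₚ : p ≢ 2 → 1ₚ ≢ -ₚ 1ₚ
  1ₚ≢-1ₚ p≢2 1≡-1 = 2ₚ≢0ₚ p≢2 (begin
    2ₚ             ≡⟨ []ₚ-+ 1 1 ⟨
    1ₚ +ₚ 1ₚ       ≡⟨ cong (1ₚ +ₚ_) 1≡-1 ⟩
    1ₚ +ₚ (-ₚ 1ₚ)  ≡⟨ -‿inverseʳ 1ₚ ⟩
    0ₚ             ∎)

  -- If every element had a square root, a choice of roots would be an injective
  -- (hence surjective) map, making squaring injective, but 1² = (-1)².
  ∃¬IsSquare : p ≢ 2 → ∃ λ n → ¬ IsSquare n
  ∃¬IsSquare p≢2 with all? IsSquare?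
  ... | no ¬allSquares = ¬∀⟶∃¬ p IsSquare IsSquare? ¬allSquares
  ... | yes allSquares = contradiction (squaring-injective 1²≡[-1]²) (1ₚ≢-1ₚ p≢2)
    where
    root : ZMod p → ZMod p
    root n = proj₁ (allSquares n)

    root² : ∀ n → root n *ₚ root n ≡ n
    root² n = proj₂ (allSquares n)

    root-injective : Injective _≡_ _≡_ root
    root-injective {m} {n} rm≡rn = trans (sym (root² m)) (trans (cong (λ r → r *ₚ r) rm≡rn) (root² n))

    squaring-injective : ∀ {x y} → x *ₚ x ≡ y *ₚ y → x ≡ y
    squaring-injective {x} {y} xx≡yy
      with m , refl ← injective⇒surjective root root-injective x
         | n , refl ← injective⇒surjective root root-injective y
      = cong root (trans (sym (root² m)) (trans xx≡yy (root² n)))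

    1²≡[-1]² : 1ₚ *ₚ 1ₚ ≡ (-ₚ 1ₚ) *ₚ (-ₚ 1ₚ)
    1²≡[-1]² = solve 0 (con (+ 1) :* con (+ 1) := (:- con (+ 1)) :* (:- con (+ 1))) refl

module PrimeFieldFibres (p : ℕ) .{{_ : NonZero p}} (p-prime : Prime p) where

  open ZModRing p
  open PrimeField p p-prime
  open Solver using (solve; _:*_; _:=_; con)

  affine⇒fibre≤1 : ∀ {f : ZMod p → ZMod p} {c d} → c ≢ 0ₚ → (∀ t → f t ≡ c *ₚ t +ₚ d) →
                   ∀ k → fibre-size f (allFin p) k ≤ 1
  affine⇒fibre≤1 {f} {c} {d} c≢0 f≡ k = count≤1 _ (allFin⁺ p) λ {t} {t′} _ _ ft≡k ft′≡k →
    *ₚ-cancelˡ c≢0 (+-cancelʳ d _ _ (trans (sym (f≡ t)) (trans ft≡k (trans (sym ft′≡k) (f≡ t′)))))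

  scaled-square : ZMod p → ZMod p → ZMod p → ZMod p
  scaled-square a β t = a *ₚ ((t +ₚ β) *ₚ (t +ₚ β))

  module _ {a} (a≢0 : a ≢ 0ₚ) (β : ZMod p) where

    scaled-square-fibre≤2 : ∀ m → fibre-size (scaled-square a β) (allFin p) m ≤ 2
    scaled-square-fibre≤2 m = count≤2 _ (λ t → (-ₚ (t +ₚ β)) -ₚ β) (allFin⁺ p) λ {t} {t′} qt≡m qt′≡m →
      Sum.map (+-cancelʳ β t t′) (x≈z//y t β _)
        (x*x≡y*y⇒x≡y⊎x≡-y (*ₚ-cancelˡ a≢0 (trans qt≡m (sym qt′≡m))))

    scaled-square-fibre[0]≤1 : fibre-size (scaled-square a β) (allFin p) 0ₚ ≤ 1
    scaled-square-fibre[0]≤1 = count≤1 _ (allFin⁺ p) λ {t} {t′} _ _ qt≡0 qt′≡0 →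
      +-cancelʳ β t t′ (trans (root qt≡0) (sym (root qt′≡0)))
      where
      root : ∀ {t} → scaled-square a β t ≡ 0ₚ → t +ₚ β ≡ 0ₚ
      root qt≡0 = x*x≡0⇒x≡0 (Sum.[ (λ a≡0 → contradiction a≡0 a≢0) , id ] (x*y≡0⇒x≡0⊎y≡0 qt≡0))

  -- For a non-square n, the values m ≠ 0 taken by (t + β)² and by n (s + γ)² are disjoint.
  square-fibres≤2 : ∀ {n} → ¬ IsSquare n → ∀ β γ m →
    fibre-size (scaled-square 1ₚ β) (allFin p) m ℕ.+ fibre-size (scaled-square n γ) (allFin p) m ≤ 2
  square-fibres≤2 {n} n-nonSquare β γ m with m ≟ᶠ 0ₚ
  ... | yes refl = ℕ.+-mono-≤ (scaled-square-fibre[0]≤1 1ₚ≢0ₚ β) (scaled-square-fibre[0]≤1 n≢0 γ)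
    where n≢0 = ¬IsSquare⇒≢0 n-nonSquare
  ... | no m≢0 = by-roots (any? λ t → scaled-square 1ₚ β t ≟ᶠ m) (any? λ s → scaled-square n γ s ≟ᶠ m)
    where
    fibre₁ = fibre-size (scaled-square 1ₚ β) (allFin p) m
    fibre₂ = fibre-size (scaled-square n γ) (allFin p) m

    no-roots : ∀ a β → ¬ (∃ λ t → scaled-square a β t ≡ m) →
               fibre-size (scaled-square a β) (allFin p) m ≡ 0
    no-roots a β ∄t =
      count≡0 (λ t → scaled-square a β t ≟ᶠ m) {allFin p} (All.tabulate λ {t} _ qt≡m → ∄t (t , qt≡m))

    by-roots : Dec (∃ λ t → scaled-square 1ₚ β t ≡ m) → Dec (∃ λ s → scaled-square n γ s ≡ m) →
               fibre₁ ℕ.+ fibre₂ ≤ 2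
    by-roots (no ∄t) _ = begin
      fibre₁ ℕ.+ fibre₂  ≡⟨ cong (ℕ._+ fibre₂) (no-roots 1ₚ β ∄t) ⟩
      fibre₂             ≤⟨ scaled-square-fibre≤2 (¬IsSquare⇒≢0 n-nonSquare) γ m ⟩
      2                  ∎
      where open ℕ.≤-Reasoning
    by-roots (yes _) (no ∄s) = begin
      fibre₁ ℕ.+ fibre₂  ≡⟨ cong (fibre₁ ℕ.+_) (no-roots n γ ∄s) ⟩
      fibre₁ ℕ.+ 0       ≡⟨ ℕ.+-identityʳ fibre₁ ⟩
      fibre₁             ≤⟨ scaled-square-fibre≤2 1ₚ≢0ₚ β m ⟩
      2                  ∎
      where open ℕ.≤-Reasoning
    by-roots (yes (t , qt≡m)) (yes (s , qs≡m)) = contradiction (x*x≡n*y*y⇒IsSquare {x = t +ₚ β} s+γ≢0 (begin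
      (t +ₚ β) *ₚ (t +ₚ β)         ≡⟨ *-identityˡ _ ⟨
      scaled-square 1ₚ β t         ≡⟨ qt≡m ⟩
      m                            ≡⟨ qs≡m ⟨
      n *ₚ ((s +ₚ γ) *ₚ (s +ₚ γ))  ∎)) n-nonSquare
      where
      open ≡-Reasoning
      s+γ≢0 : s +ₚ γ ≢ 0ₚ
      s+γ≢0 s+γ≡0 = m≢0 (begin
        m                            ≡⟨ qs≡m ⟨
        n *ₚ ((s +ₚ γ) *ₚ (s +ₚ γ))  ≡⟨ cong (λ u → n *ₚ (u *ₚ u)) s+γ≡0 ⟩
        n *ₚ (0ₚ *ₚ 0ₚ)              ≡⟨ solve 1 (λ n → n :* (con (+ 0) :* con (+ 0)) := con (+ 0)) refl n ⟩
        0ₚ                           ∎)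

module Characters {p : ℕ} .{{_ : NonZero p}} where

  open ZModRing p
  open Solver using (solve; _:+_; _:*_; _:-_; :-_; _:=_)
  open ≡-Reasoning

  ζ^-cong : ∀ {a b c d : ZMod p} → (a ≡ b → c ≡ d) → (c ≡ d → a ≡ b) → ζ^ a b ≡ ζ^ c d
  ζ^-cong {a} {b} {c} {d} ⇒ ⇐ with a ≟ᶠ b | c ≟ᶠ d
  ... | yes _   | yes _   = refl
  ... | no  _   | no  _   = refl
  ... | yes a≡b | no  c≢d = contradiction (⇒ a≡b) c≢d
  ... | no  a≢b | yes c≡d = contradiction (⇐ c≡d) a≢b

  sift-∉ : ∀ {u} (h : ZMod p → ℤ) {js} → u ∉ js →
           foldr ℤ._+_ (+ 0) (map (λ j → ζ^ u j ℤ.* h j) js) ≡ + 0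
  sift-∉     h {[]}     u∉js = refl
  sift-∉ {u} h {j ∷ js} u∉js with u ≟ᶠ j
  ... | yes u≡j = contradiction (here u≡j) u∉js
  ... | no  _   = trans (ℤ.+-identityˡ _) (sift-∉ h (u∉js ∘ there))

  sift : ∀ {u} (h : ZMod p → ℤ) {js} → Unique js → u ∈ js →
         foldr ℤ._+_ (+ 0) (map (λ j → ζ^ u j ℤ.* h j) js) ≡ h u
  sift {u} h {j ∷ js} (j∉js ∷ js!) u∈ with u ≟ᶠ j | u∈
  ... | yes refl | _ = begin
    + 1 ℤ.* h u ℤ.+ foldr ℤ._+_ (+ 0) (map (λ j → ζ^ u j ℤ.* h j) js)
      ≡⟨ cong₂ ℤ._+_ (ℤ.*-identityˡ (h u)) (sift-∉ h (λ u∈js → All.lookup j∉js u∈js refl)) ⟩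
    h u ℤ.+ + 0  ≡⟨ ℤ.+-identityʳ (h u) ⟩
    h u          ∎
  ... | no u≢j | here u≡j    = contradiction u≡j u≢j
  ... | no _   | there u∈js  = trans (ℤ.+-identityˡ _) (sift h js! u∈js)

  ζ^-*ᶜ-conjᶜ : ∀ u v k → (ζ^ u *ᶜ conjᶜ (ζ^ v)) k ≡ ζ^ (u -ₚ v) k
  ζ^-*ᶜ-conjᶜ u v k = begin
    sumₚ (λ j → ζ^ u j ℤ.* ζ^ v (-ₚ (k -ₚ j)))  ≡⟨ sift (λ j → ζ^ v (-ₚ (k -ₚ j))) (allFin⁺ p) (∈-allFin u) ⟩
    ζ^ v (-ₚ (k -ₚ u))                          ≡⟨ ζ^-cong v≡⇒ ⇒v≡ ⟩
    ζ^ (u -ₚ v) k                               ∎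
    where
    v≡⇒ : v ≡ -ₚ (k -ₚ u) → u -ₚ v ≡ k
    v≡⇒ refl = solve 2 (λ u k → u :- (:- (k :- u)) := k) refl u k
    ⇒v≡ : u -ₚ v ≡ k → v ≡ -ₚ (k -ₚ u)
    ⇒v≡ refl = solve 2 (λ u v → v := :- ((u :- v) :- u)) refl u v

  module _ {d : ℕ} where

    phase : Pt p d → Pt p d → Pt p d → ZMod p
    phase a b x = dot a x -ₚ dot b x

    sumᶜ-χ*conjχ : ∀ a b xs k →
      sumᶜ (map (λ x → χ a x *ᶜ conjᶜ (χ b x)) xs) k ≡ + fibre-size (phase a b) xs k
    sumᶜ-χ*conjχ a b []       k = refl
    sumᶜ-χ*conjχ a b (x ∷ xs) k
      rewrite ζ^-*ᶜ-conjᶜ (dot a x) (dot b x) k | sumᶜ-χ*conjχ a b xs k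
      with phase a b x ≟ᶠ k
    ... | yes _ = refl
    ... | no  _ = refl

    phase-swap : ∀ a b x → phase a b x ≡ -ₚ phase b a x
    phase-swap a b x = solve 2 (λ u v → u :- v := :- (v :- u)) refl (dot a x) (dot b x)

    equidistributed⇒orthogonal : ∀ E a b {c} → (∀ k → fibre-size (phase a b) (elems E) k ≡ c) →
                                 innerSum E a b ≈ᶜ 0ᶜ
    equidistributed⇒orthogonal E a b {c} fibre≡c = + c , λ k → begin
      innerSum E a b k ℤ.- + 0              ≡⟨ ℤ.+-identityʳ _ ⟩
      innerSum E a b k                      ≡⟨ sumᶜ-χ*conjχ a b (elems E) k ⟩
      + fibre-size (phase a b) (elems E) k  ≡⟨ cong +_ (fibre≡c k) ⟩
      + c                                   ∎

module TilingDivisibility {p : ℕ} .{{_ : NonZero p}} where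

  open ZModRing p

  points : ∀ d → List (Pt p d)
  points ℕ.zero    = [ [] ]
  points (ℕ.suc d) = cartesianProductWith _∷_ (allFin p) (points d)

  ∈-points : ∀ {d} (x : Pt p d) → x ∈ points d
  ∈-points []      = here refl
  ∈-points (x ∷ v) = ∈-cartesianProductWith⁺ _∷_ (∈-allFin x) (∈-points v)

  points-unique : ∀ d → Unique (points d)
  points-unique ℕ.zero    = All.[] ∷ []
  points-unique (ℕ.suc d) = cartesianProductWith⁺ _∷_ Vecₚ.∷-injective (allFin⁺ p) (points-unique d)

  length-points : ∀ d → length (points d) ≡ p ^ d
  length-points ℕ.zero    = refl
  length-points (ℕ.suc d) = trans (length-cartesianProductWith _∷_ (allFin p) (points d))
    (cong₂ _*_ (length-tabulate {n = p} id) (length-points d))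

  ⊕-cancelʳ : ∀ {d} (e e′ t : Pt p d) → e ⊕ t ≡ e′ ⊕ t → e ≡ e′
  ⊕-cancelʳ []      []        []      _  = refl
  ⊕-cancelʳ (x ∷ e) (x′ ∷ e′) (y ∷ t) eq with Vecₚ.∷-injective eq
  ... | x+y≡x′+y , e⊕t≡e′⊕t = cong₂ _∷_ (+-cancelʳ y x x′ x+y≡x′+y) (⊕-cancelʳ e e′ t e⊕t≡e′⊕t)

  -- The translates E + t (t ∈ T) enumerate (ℤ/pℤ)^d without repetition.
  tiling⇒card∣ : ∀ {d} {E : List (Pt p d)} → Tiling E → card E ∣ p ^ d
  tiling⇒card∣ {d} {E} (T , cover , disjoint) = divides (length T′) (begin
    p ^ d              ≡⟨ length-points d ⟨
    length (points d)  ≡⟨ Unique∧same-elements⇒length≡ (points-unique d) translates-unique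
                                     (λ {x} _ → ∈-translates x) (λ {x} _ → ∈-points x) ⟩
    length translates   ≡⟨ length-map _ pairs ⟩
    length pairs        ≡⟨ length-cartesianProductWith _,_ T′ (elems E) ⟩
    length T′ * card E  ∎)
    where
    open ≡-Reasoning
    T′ = deduplicate _≟ᵖ_ T
    pairs = cartesianProduct T′ (elems E)
    translates = map (λ (t , e) → e ⊕ t) pairs

    translates-unique : Unique translates
    translates-unique =
      map⁺-injectiveOn (cartesianProduct⁺ (deduplicate-! _≟ᵖ_ T) (deduplicate-! _≟ᵖ_ E)) inj
      where
      inj : ∀ {te te′} → te ∈ pairs → te′ ∈ pairs →
            proj₂ te ⊕ proj₁ te ≡ proj₂ te′ ⊕ proj₁ te′ → te ≡ te′
      inj {t , e} {t′ , e′} te∈ te′∈ e⊕t≡e′⊕t′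
        with t∈ , e∈ ← ∈-cartesianProduct⁻ T′ (elems E) te∈
           | t′∈ , e′∈ ← ∈-cartesianProduct⁻ T′ (elems E) te′∈
        with refl ← disjoint e e′ t t′ (∈-deduplicate⁻ _≟ᵖ_ E e∈) (∈-deduplicate⁻ _≟ᵖ_ E e′∈)
                      (∈-deduplicate⁻ _≟ᵖ_ T t∈) (∈-deduplicate⁻ _≟ᵖ_ T t′∈) e⊕t≡e′⊕t′
        = cong (t ,_) (⊕-cancelʳ e e′ t e⊕t≡e′⊕t′)

    ∈-translates : ∀ x → x ∈ translates
    ∈-translates x with cover x
    ... | e , t , e∈E , t∈T , refl =
      ∈-map⁺ _ (∈-cartesianProduct⁺ (∈-deduplicate⁺ _≟ᵖ_ t∈T) (∈-deduplicate⁺ _≟ᵖ_ e∈E))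

module Construction (p : ℕ) .{{_ : NonZero p}} (p-prime : Prime p) (p≢2 : p ≢ 2)
               (n : ZMod p) (n-nonSquare : ¬ IsSquare n) where

  open ZModRing p
  open PrimeField p p-prime
  open PrimeFieldFibres p p-prime
  open Characters
  open TilingDivisibility
  open Solver using (solve; Polynomial; _:+_; _:*_; _:-_; :-_; _:=_; con)

  e₁ e₂ a₁ a₂ : ZMod p → Pt p 4
  e₁ t = t *ₚ t ∷ t ∷ t ∷ 1ₚ ∷ []
  e₂ t = n *ₚ (t *ₚ t) ∷ n *ₚ t ∷ t ∷ n ∷ []
  a₁ i = 1ₚ ∷ 2ₚ *ₚ i ∷ 0ₚ ∷ i *ₚ i ∷ []
  a₂ i = 0ₚ ∷ 0ₚ ∷ -ₚ (2ₚ *ₚ n *ₚ i) ∷ n *ₚ (i *ₚ i) ∷ []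

  -- The same points with polynomial entries, so that the solver sees through `phase`.
  module _ {m : ℕ} where

    dotᴾ : Vec (Polynomial m) 4 → Vec (Polynomial m) 4 → Polynomial m
    dotᴾ u v = Vec.foldr _ _:+_ (con (+ 0)) (Vec.zipWith _:*_ u v)

    phaseᴾ : Vec (Polynomial m) 4 → Vec (Polynomial m) 4 → Vec (Polynomial m) 4 → Polynomial m
    phaseᴾ u v x = dotᴾ u x :- dotᴾ v x

    e₁ᴾ a₁ᴾ : Polynomial m → Vec (Polynomial m) 4
    e₁ᴾ t = t :* t ∷ t ∷ t ∷ con (+ 1) ∷ []
    a₁ᴾ i = con (+ 1) ∷ con (+ 2) :* i ∷ con (+ 0) ∷ i :* i ∷ []

    e₂ᴾ a₂ᴾ : Polynomial m → Polynomial m → Vec (Polynomial m) 4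
    e₂ᴾ n t = n :* (t :* t) ∷ n :* t ∷ t ∷ n ∷ []
    a₂ᴾ n i = con (+ 0) ∷ con (+ 0) ∷ :- (con (+ 2) :* n :* i) ∷ n :* (i :* i) ∷ []

  phase-a₁a₁-e₁ : ∀ i j t → phase (a₁ i) (a₁ j) (e₁ t) ≡ (2ₚ *ₚ (i -ₚ j)) *ₚ t +ₚ (i *ₚ i -ₚ j *ₚ j)
  phase-a₁a₁-e₁ = solve 3 (λ i j t →
    phaseᴾ (a₁ᴾ i) (a₁ᴾ j) (e₁ᴾ t)
      := (con (+ 2) :* (i :- j)) :* t :+ (i :* i :- j :* j)) refl

  phase-a₁a₁-e₂ : ∀ i j t →
    phase (a₁ i) (a₁ j) (e₂ t) ≡ (2ₚ *ₚ (i -ₚ j) *ₚ n) *ₚ t +ₚ (i *ₚ i -ₚ j *ₚ j) *ₚ n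
  phase-a₁a₁-e₂ = solve 4 (λ n i j t →
    phaseᴾ (a₁ᴾ i) (a₁ᴾ j) (e₂ᴾ n t)
      := (con (+ 2) :* (i :- j) :* n) :* t :+ (i :* i :- j :* j) :* n) refl n

  phase-a₂a₂-e₁ : ∀ i j t →
    phase (a₂ i) (a₂ j) (e₁ t) ≡ (2ₚ *ₚ n *ₚ (j -ₚ i)) *ₚ t +ₚ n *ₚ (i *ₚ i -ₚ j *ₚ j)
  phase-a₂a₂-e₁ = solve 4 (λ n i j t →
    phaseᴾ (a₂ᴾ n i) (a₂ᴾ n j) (e₁ᴾ t)
      := (con (+ 2) :* n :* (j :- i)) :* t :+ n :* (i :* i :- j :* j)) refl n

  phase-a₂a₂-e₂ : ∀ i j t →
    phase (a₂ i) (a₂ j) (e₂ t) ≡ (2ₚ *ₚ n *ₚ (j -ₚ i)) *ₚ t +ₚ n *ₚ (i *ₚ i -ₚ j *ₚ j) *ₚ n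
  phase-a₂a₂-e₂ = solve 4 (λ n i j t →
    phaseᴾ (a₂ᴾ n i) (a₂ᴾ n j) (e₂ᴾ n t)
      := (con (+ 2) :* n :* (j :- i)) :* t :+ n :* (i :* i :- j :* j) :* n) refl n

  c₀ : ZMod p → ZMod p → ZMod p
  c₀ i j = -ₚ (n *ₚ n *ₚ j *ₚ j +ₚ 2ₚ *ₚ i *ₚ n *ₚ j +ₚ n *ₚ j *ₚ j)

  phase-a₁a₂-e₁ : ∀ i j t → phase (a₁ i) (a₂ j) (e₁ t) ≡ scaled-square 1ₚ (i +ₚ n *ₚ j) t +ₚ c₀ i j
  phase-a₁a₂-e₁ = solve 4 (λ n i j t →
    phaseᴾ (a₁ᴾ i) (a₂ᴾ n j) (e₁ᴾ t)
      := con (+ 1) :* ((t :+ (i :+ n :* j)) :* (t :+ (i :+ n :* j)))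
         :+ :- (n :* n :* j :* j :+ con (+ 2) :* i :* n :* j :+ n :* j :* j)) refl n

  phase-a₁a₂-e₂ : ∀ i j t → phase (a₁ i) (a₂ j) (e₂ t) ≡ scaled-square n (i +ₚ j) t +ₚ c₀ i j
  phase-a₁a₂-e₂ = solve 4 (λ n i j t →
    phaseᴾ (a₁ᴾ i) (a₂ᴾ n j) (e₂ᴾ n t)
      := n :* ((t :+ (i :+ j)) :* (t :+ (i :+ j)))
         :+ :- (n :* n :* j :* j :+ con (+ 2) :* i :* n :* j :+ n :* j :* j)) refl n

  fibre-split : ∀ a b k → fibre-size (phase a b) (Eset n) k ≡
    fibre-size (phase a b ∘ e₁) (allFin p) k ℕ.+ fibre-size (phase a b ∘ e₂) (allFin p) k
  fibre-split a b k = trans (count-++ (λ x → phase a b x ≟ᶠ k) (map e₁ (allFin p)) (map e₂ (allFin p)))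
    (cong₂ ℕ._+_ (count-map (λ x → phase a b x ≟ᶠ k) e₁ (allFin p))
                 (count-map (λ x → phase a b x ≟ᶠ k) e₂ (allFin p)))

  n≢0 : n ≢ 0ₚ
  n≢0 = ¬IsSquare⇒≢0 n-nonSquare

  fibres-a₁a₁ : ∀ {i j} → i ≢ j → ∀ k → fibre-size (phase (a₁ i) (a₁ j)) (Eset n) k ≤ 2
  fibres-a₁a₁ {i} {j} i≢j k = ℕ.≤-trans (ℕ.≤-reflexive (fibre-split (a₁ i) (a₁ j) k)) (ℕ.+-mono-≤
    (affine⇒fibre≤1 slope≢0 (phase-a₁a₁-e₁ i j) k)
    (affine⇒fibre≤1 (x≢0∧y≢0⇒x*y≢0 slope≢0 n≢0) (phase-a₁a₁-e₂ i j) k))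
    where
    slope≢0 : 2ₚ *ₚ (i -ₚ j) ≢ 0ₚ
    slope≢0 = x≢0∧y≢0⇒x*y≢0 (2ₚ≢0ₚ p≢2) (x≢y⇒x-y≢0 i≢j)

  fibres-a₂a₂ : ∀ {i j} → i ≢ j → ∀ k → fibre-size (phase (a₂ i) (a₂ j)) (Eset n) k ≤ 2
  fibres-a₂a₂ {i} {j} i≢j k = ℕ.≤-trans (ℕ.≤-reflexive (fibre-split (a₂ i) (a₂ j) k)) (ℕ.+-mono-≤
    (affine⇒fibre≤1 slope≢0 (phase-a₂a₂-e₁ i j) k)
    (affine⇒fibre≤1 slope≢0 (phase-a₂a₂-e₂ i j) k))
    where
    slope≢0 : 2ₚ *ₚ n *ₚ (j -ₚ i) ≢ 0ₚ
    slope≢0 = x≢0∧y≢0⇒x*y≢0 (x≢0∧y≢0⇒x*y≢0 (2ₚ≢0ₚ p≢2) n≢0) (x≢y⇒x-y≢0 (i≢j ∘ sym))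

  fibres-a₁a₂ : ∀ i j k → fibre-size (phase (a₁ i) (a₂ j)) (Eset n) k ≤ 2
  fibres-a₁a₂ i j k = begin
    fibre-size (phase (a₁ i) (a₂ j)) (Eset n) k
      ≡⟨ fibre-split (a₁ i) (a₂ j) k ⟩
    fibre-size (phase (a₁ i) (a₂ j) ∘ e₁) (allFin p) k
      ℕ.+ fibre-size (phase (a₁ i) (a₂ j) ∘ e₂) (allFin p) k
      ≡⟨ cong₂ ℕ._+_ (fibre-size-+ (c₀ i j) (allFin p) k (phase-a₁a₂-e₁ i j))
                     (fibre-size-+ (c₀ i j) (allFin p) k (phase-a₁a₂-e₂ i j)) ⟩
    fibre-size (scaled-square 1ₚ (i +ₚ n *ₚ j)) (allFin p) (k -ₚ c₀ i j)
      ℕ.+ fibre-size (scaled-square n (i +ₚ j)) (allFin p) (k -ₚ c₀ i j)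
      ≤⟨ square-fibres≤2 n-nonSquare (i +ₚ n *ₚ j) (i +ₚ j) (k -ₚ c₀ i j) ⟩
    2 ∎
    where open ℕ.≤-Reasoning

  fibres-a₂a₁ : ∀ i j k → fibre-size (phase (a₂ i) (a₁ j)) (Eset n) k ≤ 2
  fibres-a₂a₁ i j k = ℕ.≤-trans
    (ℕ.≤-reflexive (fibre-size-neg (Eset n) k (phase-swap (a₂ i) (a₁ j)))) (fibres-a₁a₂ j i (-ₚ k))

  ∈Aset⁻ : ∀ {a} → a ∈ Aset n → (∃ λ i → a ≡ a₁ i) ⊎ (∃ λ i → a ≡ a₂ i)
  ∈Aset⁻ a∈A = Sum.map from-map from-map (∈-++⁻ (map a₁ (allFin p)) a∈A)
    where
    from-map : ∀ {f : ZMod p → Pt p 4} {a} → a ∈ map f (allFin p) → ∃ λ i → a ≡ f i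
    from-map a∈ with i , _ , a≡fi ← ∈-map⁻ _ a∈ = i , a≡fi

  fibres≤2 : ∀ {a b} → a ∈ Aset n → b ∈ Aset n → a ≢ b → ∀ k → fibre-size (phase a b) (Eset n) k ≤ 2
  fibres≤2 a∈A b∈A a≢b with ∈Aset⁻ a∈A | ∈Aset⁻ b∈A
  ... | inj₁ (i , refl) | inj₁ (j , refl) = fibres-a₁a₁ (a≢b ∘ cong a₁)
  ... | inj₁ (i , refl) | inj₂ (j , refl) = fibres-a₁a₂ i j
  ... | inj₂ (i , refl) | inj₁ (j , refl) = fibres-a₂a₁ i j
  ... | inj₂ (i , refl) | inj₂ (j , refl) = fibres-a₂a₂ (a≢b ∘ cong a₂)

  coordinate : Fin 4 → Pt p 4 → ZMod p
  coordinate k x = Vec.lookup x k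

  images-disjoint : ∀ {f g : ZMod p → Pt p 4} → (∀ {i j} → f i ≢ g j) →
                    ∀ {x} → ¬ (x ∈ map f (allFin p) × x ∈ map g (allFin p))
  images-disjoint fi≢gj (x∈f , x∈g)
    with i , _ , refl ← ∈-map⁻ _ x∈f | j , _ , x≡gj ← ∈-map⁻ _ x∈g = fi≢gj x≡gj

  Eset-unique : Unique (Eset n)
  Eset-unique = ++⁺ (map⁺ (cong (coordinate (# 1))) (allFin⁺ p)) (map⁺ (cong (coordinate (# 2))) (allFin⁺ p))
    (images-disjoint λ e₁≡e₂ →
      n-nonSquare (1ₚ , trans (*-identityˡ 1ₚ) (cong (coordinate (# 3)) e₁≡e₂)))

  Aset-unique : Unique (Aset n)
  Aset-unique = ++⁺ (map⁺ a₁-injective (allFin⁺ p)) (map⁺ a₂-injective (allFin⁺ p))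
    (images-disjoint (1ₚ≢0ₚ ∘ cong (coordinate (# 0))))
    where
    a₁-injective : ∀ {i j} → a₁ i ≡ a₁ j → i ≡ j
    a₁-injective = *ₚ-cancelˡ (2ₚ≢0ₚ p≢2) ∘ cong (coordinate (# 1))
    a₂-injective : ∀ {i j} → a₂ i ≡ a₂ j → i ≡ j
    a₂-injective = *ₚ-cancelˡ (x≢0∧y≢0⇒x*y≢0 (2ₚ≢0ₚ p≢2) n≢0) ∘ -‿injective ∘ cong (coordinate (# 2))

  length-images : ∀ (f g : ZMod p → Pt p 4) → length (map f (allFin p) ++ map g (allFin p)) ≡ 2 * p
  length-images f g = begin
    length (map f (allFin p) ++ map g (allFin p))
      ≡⟨ length-++ (map f (allFin p)) ⟩
    length (map f (allFin p)) ℕ.+ length (map g (allFin p))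
      ≡⟨ cong₂ ℕ._+_ (length-map f (allFin p)) (length-map g (allFin p)) ⟩
    length (allFin p) ℕ.+ length (allFin p)
      ≡⟨ cong (λ l → l ℕ.+ l) (length-tabulate {n = p} id) ⟩
    p ℕ.+ p
      ≡⟨ cong (p ℕ.+_) (ℕ.+-identityʳ p) ⟨
    2 * p
      ∎
    where open ≡-Reasoning

  card-Eset : card (Eset n) ≡ 2 * p
  card-Eset = trans (cong length (deduplicate-Unique _≟ᵖ_ Eset-unique)) (length-images e₁ e₂)

  card-Aset : card (Aset n) ≡ 2 * p
  card-Aset = trans (cong length (deduplicate-Unique _≟ᵖ_ Aset-unique)) (length-images a₁ a₂)

  spectral : Spectral (Eset n) (Aset n)
  spectral = trans card-Aset (sym card-Eset) , orthogonal
    where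
    orthogonal : ∀ a b → a ∈ Aset n → b ∈ Aset n → a ≢ b → innerSum (Eset n) a b ≈ᶜ 0ᶜ
    orthogonal a b a∈A b∈A a≢b = equidistributed⇒orthogonal (Eset n) a b λ k → begin
      fibre-size (phase a b) (elems (Eset n)) k
        ≡⟨ cong (λ xs → fibre-size (phase a b) xs k) (deduplicate-Unique _≟ᵖ_ Eset-unique) ⟩
      fibre-size (phase a b) (Eset n) k
        ≡⟨ fibres≤c⇒fibres≡c (phase a b) (Eset n) (fibres≤2 a∈A b∈A a≢b) (length-images e₁ e₂) k ⟩
      2
        ∎
      where open ≡-Reasoning

  ¬tiling : ¬ Tiling (Eset n)
  ¬tiling tiling =
    prime≢2⇒2∤^ p-prime p≢2 4 (∣-trans (m∣m*n p) (subst (_∣ p ^ 4) card-Eset (tiling⇒card∣ tiling)))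

mainTheorem2 : ((p : ℕ) .{{_ : NonZero p}} → Prime p → ¬ (p ≡ 2) →
      (n : ZMod p) → ¬ IsSquare n →
        (card (Eset n) ≡ 2 * p) × Spectral (Eset n) (Aset n) × ¬ Tiling (Eset n))
    ×
    ((p : ℕ) .{{_ : NonZero p}} → Prime p → ¬ (p ≡ 2) →
      ∃ λ (E : List (Pt p 4)) →
        (card E ≡ 2 * p) × (∃ λ (A : List (Pt p 4)) → Spectral E A) × ¬ Tiling E)
mainTheorem2 = example , λ p p-prime p≢2 →
  let n , n-nonSquare          = PrimeField.∃¬IsSquare p p-prime p≢2
      card≡ , spectral , ¬tiling = example p p-prime p≢2 n n-nonSquare
  in Eset n , card≡ , (Aset n , spectral) , ¬tiling
  where
  example : (p : ℕ) .{{_ : NonZero p}} → Prime p → ¬ (p ≡ 2) → (n : ZMod p) → ¬ IsSquare n →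
            (card (Eset n) ≡ 2 * p) × Spectral (Eset n) (Aset n) × ¬ Tiling (Eset n)
  example p p-prime p≢2 n n-nonSquare = card-Eset , spectral , ¬tiling
    where open Construction p p-prime p≢2 n n-nonSquare
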